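{- Let $m\ge1$ and define $\binom{n}{k}_m$ for $0\le k\le n$ by $\binom{n}{0}_m=1$, $\binom{n}{n}_m=\delta_{n\bmod m,0}$ (for all $n\ge0$), and $\binom{n}{k}_m=\binom{n-1}{k}_m+\binom{n-1}{k-1}_m$ for $0<k<n$. Then the generating function of the row sums is \[ \sum_{n\ge0}\Bigl(\sum_{k=0}^n\binom{n}{k}_m\Bigr)x^n=\frac{1-x}{(1-x^m)(1-2x)}=\frac{1}{(1+x+\cdots+x^{m-1})(1-2x)}. \]
   Context: $\delta_{i,j}$ is $1$ if $i=j$ and $0$ otherwise. -}

module Defs where

open import Data.Nat as ℕ using (ℕ; zero; suc; NonZero; _≟_; _<?_)
open import Data.Nat.DivMod using (_%_)
open import Data.Integer as ℤ using (ℤ; +_; -_)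
open import Data.List using (List; []; _∷_; map; upTo)
open import Data.Nat.ListAction using (sum)
open import Data.Bool using (if_then_else_)
open import Relation.Nullary.Decidable using (⌊_⌋)

δ : ℕ → ℕ → ℕ
δ i j = if ⌊ i ≟ j ⌋ then 1 else 0

-- m-binomial coefficients  binom m n k = (n choose k)_m  for 0 ≤ k ≤ n;
-- extended by 0 for k > n (these values are never summed in the row sum).
binom : (m : ℕ) .{{_ : NonZero m}} → ℕ → ℕ → ℕ
binom m n       zero    = 1
binom m zero    (suc k) = 0
binom m (suc n) (suc k) =
  if ⌊ k ≟ n ⌋ then δ (suc n % m) 0
  else (if ⌊ k <? n ⌋ then binom m n (suc k) ℕ.+ binom m n k else 0)

sumℤ : List ℤ → ℤ
sumℤ []       = + 0
sumℤ (x ∷ xs) = x ℤ.+ sumℤ xs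

rowSum : (m : ℕ) .{{_ : NonZero m}} → ℕ → ℕ
rowSum m n = sum (map (binom m n) (upTo (suc n)))

Series : Set
Series = ℕ → ℤ

_⊛_ : Series → Series → Series
(f ⊛ g) n = sumℤ (map (λ i → f i ℤ.* g (n ℕ.∸ i)) (upTo (suc n)))

infixl 7 _⊛_

poly : List ℤ → Series
poly []       n       = + 0
poly (c ∷ cs) zero    = c
poly (c ∷ cs) (suc n) = poly cs n

rowGF : (m : ℕ) .{{_ : NonZero m}} → Series
rowGF m n = + rowSum m n

oneS : Series
oneS = poly (+ 1 ∷ [])

oneMinusX : Series
oneMinusX = poly (+ 1 ∷ - + 1 ∷ [])

oneMinus2X : Series
oneMinus2X = poly (+ 1 ∷ - + 2 ∷ [])

oneMinusXPow : ℕ → Series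
oneMinusXPow m n = + δ n 0 ℤ.- + δ n m

geomPoly : ℕ → Series
geomPoly m n = if ⌊ n <? m ⌋ then + 1 else + 0

-- Write Rₙ for the row sums and Dₙ = [m ∣ n] for the diagonal entries. By Pascal's rule the
-- interior of row n+1 is row n without its first entry plus row n without its last entry, so
-- Rₙ₊₁ = 2Rₙ - Dₙ + Dₙ₊₁, i.e. R·(1-2x) = D·(1-x). As D·(1-xᵐ) = 1, this gives
-- R·(1-xᵐ)(1-2x) = 1-x. For the second identity, (1+x+⋯+x^(m-1))·(1-x) = 1-xᵐ, and the factor
-- 1-x can be cancelled. Products are never reassociated: each polynomial factor acts as the
-- operator f ↦ f·(1 - c xʲ), and these operators commute with each other and with ⊛ on the right.
module Submission where

open import Defs
open import Data.Nat using (ℕ; NonZero)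
open import Data.Product using (_×_)
open import Relation.Binary.PropositionalEquality using (_≡_)

open import Data.Product using (_,_)
open import Data.Nat as ℕ using (zero; suc; _≟_; _<?_; _<_; z<s; s<s; >-nonZero⁻¹)
open import Data.Nat.Properties as ℕ using (≮⇒≥; m≤n⇒∃[o]m+o≡n)
open import Data.Nat.DivMod using (_%_; m<n⇒m%n≡m; [m+n]%n≡m%n)
open import Data.Integer using (ℤ; +_; -_; _+_; _-_; _*_)
open import Data.Integer.Properties as ℤ using (pos-+)
open import Data.Integer.Tactic.RingSolver using (solve-∀)
open import Data.List using ([]; _∷_; map; upTo; applyUpTo)
open import Data.List.Properties using (map-upTo; map-applyUpTo; map-cong)
open import Data.Nat.ListAction using (sum)
open import Function using (_∘_)
open import Relation.Nullary using (yes; no)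
open import Relation.Nullary.Decidable using (dec-no; dec-yes-irr)
open import Relation.Binary.PropositionalEquality
  using (_≗_; refl; sym; trans; cong; cong₂; _→-setoid_; module ≡-Reasoning)
import Relation.Binary.Reasoning.Setoid as SetoidReasoning

∑ : ℕ → (ℕ → ℤ) → ℤ
∑ n f = sumℤ (applyUpTo f n)

∑-cong : ∀ n {f g : ℕ → ℤ} → (∀ i → i < n → f i ≡ g i) → ∑ n f ≡ ∑ n g
∑-cong zero    eq = refl
∑-cong (suc n) eq = cong₂ _+_ (eq 0 z<s) (∑-cong n (λ i i<n → eq (suc i) (s<s i<n)))

∑-last : ∀ n f → ∑ (suc n) f ≡ ∑ n f + f n
∑-last zero    f = trans (ℤ.+-identityʳ (f 0)) (sym (ℤ.+-identityˡ (f 0)))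
∑-last (suc n) f = trans (cong (_+_ (f 0)) (∑-last n (f ∘ suc))) (sym (ℤ.+-assoc (f 0) _ _))

∑-zero : ∀ n → ∑ n (λ _ → + 0) ≡ + 0
∑-zero zero    = refl
∑-zero (suc n) = trans (ℤ.+-identityˡ _) (∑-zero n)

∑-+ : ∀ n f g → ∑ n (λ i → f i + g i) ≡ ∑ n f + ∑ n g
∑-+ zero    f g = refl
∑-+ (suc n) f g = trans (cong (_+_ (f 0 + g 0)) (∑-+ n (f ∘ suc) (g ∘ suc)))
                        (interchange (f 0) (g 0) (∑ n (f ∘ suc)) (∑ n (g ∘ suc)))
  where open import Algebra.Properties.CommutativeSemigroup ℤ.+-commutativeSemigroup using (interchange)

∑-*ˡ : ∀ n c f → ∑ n (λ i → c * f i) ≡ c * ∑ n f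
∑-*ˡ zero    c f = sym (ℤ.*-zeroʳ c)
∑-*ˡ (suc n) c f = trans (cong (_+_ (c * f 0)) (∑-*ˡ n c (f ∘ suc)))
                         (sym (ℤ.*-distribˡ-+ c (f 0) (∑ n (f ∘ suc))))

∑-linear : ∀ n c f g → ∑ n (λ i → f i - c * g i) ≡ ∑ n f - c * ∑ n g
∑-linear n c f g = begin
  ∑ n (λ i → f i - c * g i)        ≡⟨ ∑-+ n f (λ i → - (c * g i)) ⟩
  ∑ n f + ∑ n (λ i → - (c * g i))  ≡⟨ cong (_+_ (∑ n f)) (∑-cong n λ i _ → ℤ.neg-distribˡ-* c (g i)) ⟩
  ∑ n f + ∑ n (λ i → (- c) * g i)  ≡⟨ cong (_+_ (∑ n f)) (∑-*ˡ n (- c) g) ⟩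
  ∑ n f + (- c) * ∑ n g            ≡⟨ cong (_+_ (∑ n f)) (ℤ.neg-distribˡ-* c (∑ n g)) ⟨
  ∑ n f - c * ∑ n g                ∎
  where open ≡-Reasoning

shift : ℕ → Series → Series
shift zero    f n       = f n
shift (suc j) f zero    = + 0
shift (suc j) f (suc n) = shift j f n

shift-cong : ∀ j {f g} → f ≗ g → shift j f ≗ shift j g
shift-cong zero    f≗g n       = f≗g n
shift-cong (suc j) f≗g zero    = refl
shift-cong (suc j) f≗g (suc n) = shift-cong j f≗g n

shift-below : ∀ j f {n} → n < j → shift j f n ≡ + 0
shift-below (suc j) f {zero}  _         = refl
shift-below (suc j) f {suc n} (s<s n<j) = shift-below j f n<j

shift-+ : ∀ j f n → shift j f (j ℕ.+ n) ≡ f n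
shift-+ zero    f n = refl
shift-+ (suc j) f n = shift-+ j f n

shift-shift : ∀ j k f → shift j (shift k f) ≗ shift (j ℕ.+ k) f
shift-shift zero    k f n       = refl
shift-shift (suc j) k f zero    = refl
shift-shift (suc j) k f (suc n) = shift-shift j k f n

shift-comm : ∀ j k f → shift j (shift k f) ≗ shift k (shift j f)
shift-comm j k f n = begin
  shift j (shift k f) n  ≡⟨ shift-shift j k f n ⟩
  shift (j ℕ.+ k) f n    ≡⟨ cong (λ l → shift l f n) (ℕ.+-comm j k) ⟩
  shift (k ℕ.+ j) f n    ≡⟨ shift-shift k j f n ⟨
  shift k (shift j f) n  ∎
  where open ≡-Reasoning

-- The product f·(1 - c xʲ); shift j is multiplication by xʲ.
_·[1-_x^_] : Series → ℤ → ℕ → Series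
(f ·[1- c x^ j ]) n = f n - c * shift j f n

·[1-x^]-cong : ∀ c j {f g} → f ≗ g → f ·[1- c x^ j ] ≗ g ·[1- c x^ j ]
·[1-x^]-cong c j f≗g n = cong₂ (λ a b → a - c * b) (f≗g n) (shift-cong j f≗g n)

shift-·[1-x^] : ∀ j c k f → shift j (f ·[1- c x^ k ]) ≗ shift j f ·[1- c x^ k ]
shift-·[1-x^] zero    c k f n       = refl
shift-·[1-x^] (suc j) c k f zero    = begin
  + 0                                      ≡⟨ 0-c*0≡0 c ⟨
  + 0 - c * + 0                            ≡⟨ cong (λ a → + 0 - c * a) (shift-comm k (suc j) f 0) ⟨
  + 0 - c * shift k (shift (suc j) f) 0    ∎
  where
  open ≡-Reasoning
  0-c*0≡0 : ∀ c → + 0 - c * + 0 ≡ + 0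
  0-c*0≡0 = solve-∀
shift-·[1-x^] (suc j) c k f (suc n) = begin
  shift j (f ·[1- c x^ k ]) n                           ≡⟨ shift-·[1-x^] j c k f n ⟩
  shift j f n - c * shift k (shift j f) n               ≡⟨ cong (λ a → shift j f n - c * a) shifts-agree ⟩
  shift j f n - c * shift k (shift (suc j) f) (suc n)   ∎
  where
  open ≡-Reasoning
  shifts-agree : shift k (shift j f) n ≡ shift k (shift (suc j) f) (suc n)
  shifts-agree = trans (shift-comm k j f n) (shift-comm (suc j) k f (suc n))

·[1-x^]-comm : ∀ c j d k f →
  (f ·[1- c x^ j ]) ·[1- d x^ k ] ≗ (f ·[1- d x^ k ]) ·[1- c x^ j ]
·[1-x^]-comm c j d k f n = begin
  (f n - c * shift j f n) - d * shift k (f ·[1- c x^ j ]) n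
    ≡⟨ cong (λ a → (f n - c * shift j f n) - d * a) (shift-·[1-x^] k c j f n) ⟩
  (f n - c * shift j f n) - d * (shift k f n - c * shift j (shift k f) n)
    ≡⟨ cong (λ a → (f n - c * shift j f n) - d * (shift k f n - c * a)) (shift-comm j k f n) ⟩
  (f n - c * shift j f n) - d * (shift k f n - c * shift k (shift j f) n)
    ≡⟨ swap c d (f n) (shift j f n) (shift k f n) (shift k (shift j f) n) ⟩
  (f n - d * shift k f n) - c * (shift j f n - d * shift k (shift j f) n)
    ≡⟨ cong (λ a → (f n - d * shift k f n) - c * a) (shift-·[1-x^] j d k f n) ⟨
  (f n - d * shift k f n) - c * shift j (f ·[1- d x^ k ]) n
    ∎
  where
  open ≡-Reasoning
  swap : ∀ c d a p q r → (a - c * p) - d * (q - c * r) ≡ (a - d * q) - c * (p - d * r)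
  swap = solve-∀

⊛-as-∑ : ∀ f g n → (f ⊛ g) n ≡ ∑ (suc n) (λ i → f i * g (n ℕ.∸ i))
⊛-as-∑ f g n = cong sumℤ (map-upTo (λ i → f i * g (n ℕ.∸ i)) (suc n))

⊛-congʳ : ∀ f {g h} → g ≗ h → f ⊛ g ≗ f ⊛ h
⊛-congʳ f g≗h n = cong sumℤ (map-cong (λ i → cong (f i *_) (g≗h (n ℕ.∸ i))) (upTo (suc n)))

⊛-linearʳ : ∀ c f g h → f ⊛ (λ n → g n - c * h n) ≗ λ n → (f ⊛ g) n - c * (f ⊛ h) n
⊛-linearʳ c f g h n = begin
  (f ⊛ (λ n → g n - c * h n)) n
    ≡⟨ ⊛-as-∑ f (λ n → g n - c * h n) n ⟩
  ∑ (suc n) (λ i → f i * (g (n ℕ.∸ i) - c * h (n ℕ.∸ i)))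
    ≡⟨ ∑-cong (suc n) (λ i _ → distrib c (f i) (g (n ℕ.∸ i)) (h (n ℕ.∸ i))) ⟩
  ∑ (suc n) (λ i → f i * g (n ℕ.∸ i) - c * (f i * h (n ℕ.∸ i)))
    ≡⟨ ∑-linear (suc n) c (λ i → f i * g (n ℕ.∸ i)) (λ i → f i * h (n ℕ.∸ i)) ⟩
  ∑ (suc n) (λ i → f i * g (n ℕ.∸ i)) - c * ∑ (suc n) (λ i → f i * h (n ℕ.∸ i))
    ≡⟨ cong₂ (λ a b → a - c * b) (⊛-as-∑ f g n) (⊛-as-∑ f h n) ⟨
  (f ⊛ g) n - c * (f ⊛ h) n
    ∎
  where
  open ≡-Reasoning
  distrib : ∀ c a x y → a * (x - c * y) ≡ a * x - c * (a * y)
  distrib = solve-∀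

⊛-shift1ʳ : ∀ f g → f ⊛ shift 1 g ≗ shift 1 (f ⊛ g)
⊛-shift1ʳ f g zero    = trans (ℤ.+-identityʳ _) (ℤ.*-zeroʳ (f 0))
⊛-shift1ʳ f g (suc k) = begin
  (f ⊛ shift 1 g) (suc k)
    ≡⟨ ⊛-as-∑ f (shift 1 g) (suc k) ⟩
  ∑ (suc (suc k)) (λ i → f i * shift 1 g (suc k ℕ.∸ i))
    ≡⟨ ∑-last (suc k) (λ i → f i * shift 1 g (suc k ℕ.∸ i)) ⟩
  ∑ (suc k) (λ i → f i * shift 1 g (suc k ℕ.∸ i)) + f (suc k) * shift 1 g (k ℕ.∸ k)
    ≡⟨ cong₂ _+_ (∑-cong (suc k) (λ i i<1+k → cong (f i *_) (shift1-∸ (ℕ.s≤s⁻¹ i<1+k)))) last-vanishes ⟩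
  ∑ (suc k) (λ i → f i * g (k ℕ.∸ i)) + + 0
    ≡⟨ ℤ.+-identityʳ _ ⟩
  ∑ (suc k) (λ i → f i * g (k ℕ.∸ i))
    ≡⟨ ⊛-as-∑ f g k ⟨
  (f ⊛ g) k
    ∎
  where
  open ≡-Reasoning
  last-vanishes : f (suc k) * shift 1 g (k ℕ.∸ k) ≡ + 0
  last-vanishes = trans (cong (λ t → f (suc k) * shift 1 g t) (ℕ.n∸n≡0 k)) (ℤ.*-zeroʳ (f (suc k)))
  shift1-∸ : ∀ {i k} → i ℕ.≤ k → shift 1 g (suc k ℕ.∸ i) ≡ g (k ℕ.∸ i)
  shift1-∸ {zero}          _         = refl
  shift1-∸ {suc i} {suc k} (ℕ.s≤s p) = shift1-∸ p

⊛-shiftʳ : ∀ j f g → f ⊛ shift j g ≗ shift j (f ⊛ g)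
⊛-shiftʳ zero    f g = λ n → refl
⊛-shiftʳ (suc j) f g = begin
  f ⊛ shift (suc j) g          ≈⟨ ⊛-congʳ f (shift-shift 1 j g) ⟨
  f ⊛ shift 1 (shift j g)      ≈⟨ ⊛-shift1ʳ f (shift j g) ⟩
  shift 1 (f ⊛ shift j g)      ≈⟨ shift-cong 1 (⊛-shiftʳ j f g) ⟩
  shift 1 (shift j (f ⊛ g))    ≈⟨ shift-shift 1 j (f ⊛ g) ⟩
  shift (suc j) (f ⊛ g)        ∎
  where open SetoidReasoning (ℕ →-setoid ℤ)

⊛-identityʳ : ∀ f → f ⊛ oneS ≗ f
⊛-identityʳ f n = begin
  (f ⊛ oneS) n                                                ≡⟨ ⊛-as-∑ f oneS n ⟩
  ∑ (suc n) (λ i → f i * oneS (n ℕ.∸ i))                       ≡⟨ ∑-last n (λ i → f i * oneS (n ℕ.∸ i)) ⟩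
  ∑ n (λ i → f i * oneS (n ℕ.∸ i)) + f n * oneS (n ℕ.∸ n)      ≡⟨ cong₂ _+_ off-diagonal diagonal ⟩
  + 0 + f n                                                   ≡⟨ ℤ.+-identityˡ (f n) ⟩
  f n                                                         ∎
  where
  open ≡-Reasoning
  oneS-∸ : ∀ {i n} → i < n → oneS (n ℕ.∸ i) ≡ + 0
  oneS-∸ {zero}  {suc n} _         = refl
  oneS-∸ {suc i} {suc n} (s<s i<n) = oneS-∸ i<n
  off-diagonal : ∑ n (λ i → f i * oneS (n ℕ.∸ i)) ≡ + 0
  off-diagonal = trans (∑-cong n λ i i<n → trans (cong (f i *_) (oneS-∸ i<n)) (ℤ.*-zeroʳ (f i)))
                       (∑-zero n)
  diagonal : f n * oneS (n ℕ.∸ n) ≡ f n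
  diagonal = trans (cong (λ t → f n * oneS t) (ℕ.n∸n≡0 n)) (ℤ.*-identityʳ (f n))

⊛-·[1-x^]ʳ : ∀ c j f g → f ⊛ (g ·[1- c x^ j ]) ≗ (f ⊛ g) ·[1- c x^ j ]
⊛-·[1-x^]ʳ c j f g n =
  trans (⊛-linearʳ c f g (shift j g) n) (cong (λ a → (f ⊛ g) n - c * a) (⊛-shiftʳ j f g n))

⊛-binomialʳ : ∀ c j f → f ⊛ (oneS ·[1- c x^ j ]) ≗ f ·[1- c x^ j ]
⊛-binomialʳ c j f n = trans (⊛-·[1-x^]ʳ c j f oneS n) (·[1-x^]-cong c j (⊛-identityʳ f) n)

δ-suc : ∀ n j → δ (suc n) (suc j) ≡ δ n j
δ-suc n j with n ≟ j
... | yes refl rewrite ℕ.≟-diag (refl {x = suc n}) = refl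
... | no n≢j   rewrite dec-no (suc n ≟ suc j) (n≢j ∘ ℕ.suc-injective) = refl

shift-oneS : ∀ j n → shift j oneS n ≡ + δ n j
shift-oneS zero    zero    = refl
shift-oneS zero    (suc n) = refl
shift-oneS (suc j) zero    = refl
shift-oneS (suc j) (suc n) = trans (shift-oneS j n) (cong +_ (sym (δ-suc n j)))

oneMinusX-binomial : oneMinusX ≗ oneS ·[1- + 1 x^ 1 ]
oneMinusX-binomial zero          = refl
oneMinusX-binomial (suc zero)    = refl
oneMinusX-binomial (suc (suc n)) = refl

oneMinus2X-binomial : oneMinus2X ≗ oneS ·[1- + 2 x^ 1 ]
oneMinus2X-binomial zero          = refl
oneMinus2X-binomial (suc zero)    = refl
oneMinus2X-binomial (suc (suc n)) = refl

oneMinusXPow-binomial : ∀ m → oneMinusXPow m ≗ oneS ·[1- + 1 x^ m ]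
oneMinusXPow-binomial m n = sym (cong₂ _-_ (shift-oneS 0 n) (trans (ℤ.*-identityˡ _) (shift-oneS m n)))

geomPoly-suc : ∀ m n → geomPoly (suc m) (suc n) ≡ geomPoly m n
geomPoly-suc m n with n <? m
... | yes n<m rewrite dec-yes-irr (suc n <? suc m) ℕ.<-irrelevant (s<s n<m) = refl
... | no n≮m  rewrite dec-no (suc n <? suc m) (n≮m ∘ ℕ.s<s⁻¹) = refl

geomPoly-·[1-x] : ∀ m → geomPoly m ·[1- + 1 x^ 1 ] ≗ oneMinusXPow m
geomPoly-·[1-x] zero          zero          = refl
geomPoly-·[1-x] (suc m)       zero          = refl
geomPoly-·[1-x] zero          (suc n)       = refl
geomPoly-·[1-x] (suc zero)    (suc zero)    = refl
geomPoly-·[1-x] (suc (suc m)) (suc zero)    = refl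
geomPoly-·[1-x] (suc zero)    (suc (suc n)) = refl
geomPoly-·[1-x] (suc (suc m)) (suc (suc n)) = begin
  geomPoly (suc (suc m)) (suc (suc n)) - + 1 * geomPoly (suc (suc m)) (suc n)
    ≡⟨ cong₂ (λ a b → a - + 1 * b) (geomPoly-suc (suc m) (suc n)) (geomPoly-suc (suc m) n) ⟩
  geomPoly (suc m) (suc n) - + 1 * geomPoly (suc m) n   ≡⟨ geomPoly-·[1-x] (suc m) (suc n) ⟩
  + 0 - + δ (suc n) (suc m)                             ≡⟨ cong (λ d → + 0 - + d) (δ-suc (suc n) (suc m)) ⟨
  + 0 - + δ (suc (suc n)) (suc (suc m))                 ∎
  where open ≡-Reasoning

multiplesOf : (m : ℕ) .{{_ : NonZero m}} → Series
multiplesOf m n = + δ (n % m) 0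

binom-diagonal : ∀ m .{{_ : NonZero m}} n → + binom m n n ≡ multiplesOf m n
binom-diagonal m zero    = cong (λ r → + δ r 0) (sym (m<n⇒m%n≡m (>-nonZero⁻¹ m)))
binom-diagonal m (suc n) rewrite ℕ.≟-diag (refl {x = n}) = refl

binom-pascal : ∀ m .{{_ : NonZero m}} {n k} → k < n →
  binom m (suc n) (suc k) ≡ binom m n (suc k) ℕ.+ binom m n k
binom-pascal m {n} {k} k<n
  rewrite dec-no (k ≟ n) (ℕ.<⇒≢ k<n) | dec-yes-irr (k <? n) ℕ.<-irrelevant k<n = refl

+-sum : ∀ xs → + sum xs ≡ sumℤ (map (λ x → + x) xs)
+-sum []       = refl
+-sum (x ∷ xs) = trans (pos-+ x (sum xs)) (cong (_+_ (+ x)) (+-sum xs))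

rowGF-as-∑ : ∀ m .{{_ : NonZero m}} n → rowGF m n ≡ ∑ (suc n) (λ k → + binom m n k)
rowGF-as-∑ m n = trans (+-sum (map (binom m n) (upTo (suc n))))
    (cong sumℤ (trans (cong (map (λ x → + x)) (map-upTo (binom m n) (suc n)))
                    (map-applyUpTo (binom m n) (λ x → + x) (suc n))))

rowGF-recurrence : ∀ m .{{_ : NonZero m}} →
  rowGF m ·[1- + 2 x^ 1 ] ≗ multiplesOf m ·[1- + 1 x^ 1 ]
rowGF-recurrence m zero    = cong (λ d → d - + 1 * + 0) (binom-diagonal m 0)
rowGF-recurrence m (suc n) = begin
  R (suc n) - + 2 * R n
    ≡⟨ twice (R (suc n)) (R n) ⟩
  (R (suc n) - R n) - R n
    ≡⟨ cong₂ _-_ (cong₂ _-_ expand-next drop-first) drop-last ⟩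
  ((+ 1 + ((∑ n (b ∘ suc) + ∑ n b) + D (suc n))) - (+ 1 + ∑ n (b ∘ suc))) - (∑ n b + D n)
    ≡⟨ cancel (∑ n (b ∘ suc)) (∑ n b) (D (suc n)) (D n) ⟩
  D (suc n) - + 1 * D n
    ∎
  where
  open ≡-Reasoning
  R D b b′ : ℕ → ℤ
  R = rowGF m
  D = multiplesOf m
  b k = + binom m n k
  b′ k = + binom m (suc n) k
  drop-first : R n ≡ + 1 + ∑ n (b ∘ suc)
  drop-first = rowGF-as-∑ m n
  drop-last : R n ≡ ∑ n b + D n
  drop-last = trans (rowGF-as-∑ m n) (trans (∑-last n b) (cong (_+_ (∑ n b)) (binom-diagonal m n)))
  pascal : ∀ k → k < n → b′ (suc k) ≡ b (suc k) + b k
  pascal k k<n = trans (cong +_ (binom-pascal m k<n)) (pos-+ (binom m n (suc k)) (binom m n k))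
  expand-next : R (suc n) ≡ + 1 + ((∑ n (b ∘ suc) + ∑ n b) + D (suc n))
  expand-next = begin
    R (suc n)
      ≡⟨ rowGF-as-∑ m (suc n) ⟩
    + 1 + ∑ (suc n) (b′ ∘ suc)
      ≡⟨ cong (_+_ (+ 1)) (∑-last n (b′ ∘ suc)) ⟩
    + 1 + (∑ n (b′ ∘ suc) + b′ (suc n))
      ≡⟨ cong (_+_ (+ 1)) (cong₂ _+_ (∑-cong n pascal) (binom-diagonal m (suc n))) ⟩
    + 1 + (∑ n (λ k → b (suc k) + b k) + D (suc n))
      ≡⟨ cong (λ s → + 1 + (s + D (suc n))) (∑-+ n (b ∘ suc) b) ⟩
    + 1 + ((∑ n (b ∘ suc) + ∑ n b) + D (suc n))
      ∎
  twice : ∀ r′ r → r′ - + 2 * r ≡ (r′ - r) - r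
  twice = solve-∀
  cancel : ∀ s₁ s₀ d₁ d₀ → ((+ 1 + ((s₁ + s₀) + d₁)) - (+ 1 + s₁)) - (s₀ + d₀) ≡ d₁ - + 1 * d₀
  cancel = solve-∀

multiplesOf-·[1-x^m] : ∀ m .{{_ : NonZero m}} → multiplesOf m ·[1- + 1 x^ m ] ≗ oneS
multiplesOf-·[1-x^m] (suc m) n with n <? suc m
... | yes n<m = begin
  D n - + 1 * shift (suc m) D n    ≡⟨ cong (λ s → D n - + 1 * s) (shift-below (suc m) D n<m) ⟩
  D n - + 1 * + 0                  ≡⟨ ℤ.+-identityʳ (D n) ⟩
  + δ (n % suc m) 0                ≡⟨ cong (λ r → + δ r 0) (m<n⇒m%n≡m n<m) ⟩
  + δ n 0                          ≡⟨ shift-oneS 0 n ⟨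
  oneS n                           ∎
  where
  open ≡-Reasoning
  D = multiplesOf (suc m)
... | no n≮m with m≤n⇒∃[o]m+o≡n (≮⇒≥ n≮m)
...   | i , refl = begin
  D (suc m ℕ.+ i) - + 1 * shift (suc m) D (suc m ℕ.+ i)
    ≡⟨ cong₂ (λ a s → a - + 1 * s) periodic (shift-+ (suc m) D i) ⟩
  D i - + 1 * D i
    ≡⟨ self-cancel (D i) ⟩
  + 0
    ∎
  where
  open ≡-Reasoning
  D = multiplesOf (suc m)
  periodic : D (suc m ℕ.+ i) ≡ D i
  periodic = cong (λ r → + δ r 0) (trans (cong (_% suc m) (ℕ.+-comm (suc m) i)) ([m+n]%n≡m%n i (suc m)))
  self-cancel : ∀ x → x - + 1 * x ≡ + 0
  self-cancel = solve-∀

·[1-x]-injective : ∀ c {f g} → f ·[1- c x^ 1 ] ≗ g ·[1- c x^ 1 ] → f ≗ g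
·[1-x]-injective c {f} {g} eq n = begin
  f n                                        ≡⟨ undo c (f n) (shift 1 f n) ⟨
  (f n - c * shift 1 f n) + c * shift 1 f n  ≡⟨ cong₂ (λ a s → a + c * s) (eq n) (earlier n) ⟩
  (g n - c * shift 1 g n) + c * shift 1 g n  ≡⟨ undo c (g n) (shift 1 g n) ⟩
  g n                                        ∎
  where
  open ≡-Reasoning
  undo : ∀ c x y → (x - c * y) + c * y ≡ x
  undo = solve-∀
  earlier : ∀ n → shift 1 f n ≡ shift 1 g n
  earlier zero    = refl
  earlier (suc n) = ·[1-x]-injective c {f} {g} eq n

⊛-oneMinus2X : ∀ f → f ⊛ oneMinus2X ≗ f ·[1- + 2 x^ 1 ]
⊛-oneMinus2X f n = trans (⊛-congʳ f oneMinus2X-binomial n) (⊛-binomialʳ (+ 2) 1 f n)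

⊛-oneMinusXPow : ∀ m f → f ⊛ oneMinusXPow m ≗ f ·[1- + 1 x^ m ]
⊛-oneMinusXPow m f n = trans (⊛-congʳ f (oneMinusXPow-binomial m) n) (⊛-binomialʳ (+ 1) m f n)

rowGF-·[1-x^m][1-2x] : ∀ m .{{_ : NonZero m}} →
  (rowGF m ⊛ oneMinusXPow m) ·[1- + 2 x^ 1 ] ≗ oneS ·[1- + 1 x^ 1 ]
rowGF-·[1-x^m][1-2x] m = begin
  (R ⊛ oneMinusXPow m) ·[1- + 2 x^ 1 ]              ≈⟨ ·[1-x^]-cong (+ 2) 1 (⊛-oneMinusXPow m R) ⟩
  (R ·[1- + 1 x^ m ]) ·[1- + 2 x^ 1 ]                ≈⟨ ·[1-x^]-comm (+ 1) m (+ 2) 1 R ⟩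
  (R ·[1- + 2 x^ 1 ]) ·[1- + 1 x^ m ]                ≈⟨ ·[1-x^]-cong (+ 1) m (rowGF-recurrence m) ⟩
  (multiplesOf m ·[1- + 1 x^ 1 ]) ·[1- + 1 x^ m ]    ≈⟨ ·[1-x^]-comm (+ 1) 1 (+ 1) m (multiplesOf m) ⟩
  (multiplesOf m ·[1- + 1 x^ m ]) ·[1- + 1 x^ 1 ]    ≈⟨ ·[1-x^]-cong (+ 1) 1 (multiplesOf-·[1-x^m] m) ⟩
  oneS ·[1- + 1 x^ 1 ]                              ∎
  where
  open SetoidReasoning (ℕ →-setoid ℤ)
  R = rowGF m

corollary5 : (m : ℕ) .{{_ : NonZero m}} →
    ((n : ℕ) → (rowGF m ⊛ (oneMinusXPow m ⊛ oneMinus2X)) n ≡ oneMinusX n)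
    × ((n : ℕ) → (rowGF m ⊛ (geomPoly m ⊛ oneMinus2X)) n ≡ oneS n)
corollary5 m = part₁ , part₂
  where
  open SetoidReasoning (ℕ →-setoid ℤ)
  R A G : Series
  R = rowGF m
  A = oneMinusXPow m
  G = geomPoly m
  part₁ : R ⊛ (A ⊛ oneMinus2X) ≗ oneMinusX
  part₁ = begin
    R ⊛ (A ⊛ oneMinus2X)         ≈⟨ ⊛-congʳ R (⊛-oneMinus2X A) ⟩
    R ⊛ (A ·[1- + 2 x^ 1 ])      ≈⟨ ⊛-·[1-x^]ʳ (+ 2) 1 R A ⟩
    (R ⊛ A) ·[1- + 2 x^ 1 ]      ≈⟨ rowGF-·[1-x^m][1-2x] m ⟩
    oneS ·[1- + 1 x^ 1 ]         ≈⟨ oneMinusX-binomial ⟨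
    oneMinusX                    ∎
  part₂ : R ⊛ (G ⊛ oneMinus2X) ≗ oneS
  part₂ = begin
    R ⊛ (G ⊛ oneMinus2X)         ≈⟨ ⊛-congʳ R (⊛-oneMinus2X G) ⟩
    R ⊛ (G ·[1- + 2 x^ 1 ])      ≈⟨ ⊛-·[1-x^]ʳ (+ 2) 1 R G ⟩
    (R ⊛ G) ·[1- + 2 x^ 1 ]      ≈⟨ ·[1-x]-injective (+ 1) (begin
      ((R ⊛ G) ·[1- + 2 x^ 1 ]) ·[1- + 1 x^ 1 ]   ≈⟨ ·[1-x^]-comm (+ 2) 1 (+ 1) 1 (R ⊛ G) ⟩
      ((R ⊛ G) ·[1- + 1 x^ 1 ]) ·[1- + 2 x^ 1 ]   ≈⟨ ·[1-x^]-cong (+ 2) 1 (⊛-·[1-x^]ʳ (+ 1) 1 R G) ⟨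
      (R ⊛ (G ·[1- + 1 x^ 1 ])) ·[1- + 2 x^ 1 ]   ≈⟨ ·[1-x^]-cong (+ 2) 1 (⊛-congʳ R (geomPoly-·[1-x] m)) ⟩
      (R ⊛ A) ·[1- + 2 x^ 1 ]                     ≈⟨ rowGF-·[1-x^m][1-2x] m ⟩
      oneS ·[1- + 1 x^ 1 ]                        ∎) ⟩
    oneS                         ∎
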